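{- Let $\mathcal{T}$ be a 2-diverse table. Then there is a minimum-cost 2-diverse partition of $\mathcal{T}$ in which every group consists of 2 or 3 rows with pairwise distinct sensitive attribute values.
   Context: A table $\mathcal{T}$ with $m$ quasi-identifier (QI) attributes and one sensitive attribute (SA) is a multiset of rows in $\Sigma^{m+1}$, $\Sigma$ a finite alphabet; coordinate $m+1$ is the SA. For a nonempty group $M\subseteq\mathcal{T}$, its suppression cost is $|M|$ times the number of QI coordinates on which not all rows of $M$ agree; the cost of a partition into nonempty groups is the sum of its groups' costs. A (sub-)table $M$ is $l$-diverse if at most $|M|/l$ of its rows share any single SA value; a partition is $l$-diverse if all its groups are $l$-diverse. -}

module Defs where

open import Data.Nat using (ℕ; _*_; _≤_; _+_)
open import Data.Bool using (Bool; true; not; _∧_)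
open import Data.Fin using (Fin)
open import Data.Fin.Properties using () renaming (_≟_ to _≟F_)
open import Data.Vec using (Vec; lookup)
open import Data.List using (List; []; _∷_; length; map; filter; filterᵇ; concat; allFin)
open import Data.List.Relation.Unary.All using (All)
open import Data.List.Relation.Unary.Unique.Propositional using (Unique)
open import Data.List.Relation.Binary.Permutation.Propositional using (_↭_)
open import Data.Product using (_×_; proj₁; proj₂)
open import Relation.Nullary.Decidable using (⌊_⌋)
open import Relation.Binary.PropositionalEquality using (_≡_)
open import Data.Sum using (_⊎_)

-- A row over the finite alphabet Σ = Fin s with m QI attributes:
-- its m QI coordinates together with its SA value (coordinate m+1).
Row : ℕ → ℕ → Set
Row m s = Vec (Fin s) m × Fin s

qi : ∀ {m s} → Row m s → Vec (Fin s) m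
qi = proj₁

sa : ∀ {m s} → Row m s → Fin s
sa = proj₂

-- A table (multiset of rows) with n rows, given by an enumeration of its rows.
Table : ℕ → ℕ → ℕ → Set
Table m s n = Vec (Row m s) n

occ : ∀ {s} → Fin s → List (Fin s) → ℕ
occ v xs = length (filter (λ x → x ≟F v) xs)

allSameᵇ : ∀ {s} → List (Fin s) → Bool
allSameᵇ [] = true
allSameᵇ (x ∷ xs) = allEq x xs
  where
  allEq : _ → List _ → Bool
  allEq x [] = true
  allEq x (y ∷ ys) = ⌊ y ≟F x ⌋ ∧ allEq x ys

disagreeCount : ∀ {m s} → List (Row m s) → ℕ
disagreeCount {m} rows =
  length (filterᵇ (λ j → not (allSameᵇ (map (λ r → lookup (qi r) j) rows))) (allFin m))

groupCost : ∀ {m s} → List (Row m s) → ℕ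
groupCost rows = length rows * disagreeCount rows

Diverse : ∀ {m s} → ℕ → List (Row m s) → Set
Diverse {s = s} l rows = (v : Fin s) → l * occ v (map sa rows) ≤ length rows

-- A partition of a table with n rows: a list of groups, each a nonempty
-- list of row indices, such that every row index occurs exactly once overall.
-- (Indices are used so that duplicate rows of the multiset are handled correctly.)
data NonEmptyL {A : Set} : List A → Set where
  nonEmpty : ∀ x xs → NonEmptyL (x ∷ xs)

Partition : ℕ → Set
Partition n = List (List (Fin n))

IsPartition : ∀ {n} → Partition n → Set
IsPartition {n} P = All NonEmptyL P × (concat P ↭ allFin n)

rowsOf : ∀ {m s n} → Table m s n → List (Fin n) → List (Row m s)
rowsOf T g = map (lookup T) g

cost : ∀ {m s n} → Table m s n → Partition n → ℕ
cost T [] = 0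
cost T (g ∷ P) = groupCost (rowsOf T g) + cost T P

IsDiversePartition : ∀ {m s n} → ℕ → Table m s n → Partition n → Set
IsDiversePartition l T P = IsPartition P × All (λ g → Diverse l (rowsOf T g)) P

IsMinCostDiversePartition : ∀ {m s n} → ℕ → Table m s n → Partition n → Set
IsMinCostDiversePartition l T P =
  IsDiversePartition l T P ×
  (∀ Q → IsDiversePartition l T Q → cost T P ≤ cost T Q)

SmallDistinctGroup : ∀ {m s n} → Table m s n → List (Fin n) → Set
SmallDistinctGroup T g =
  (length g ≡ 2 ⊎ length g ≡ 3) × Unique (map sa (rowsOf T g))

-- First, a 2-diverse list of at least four rows always contains two rows
-- whose removal leaves a 2-diverse list: take a row x of a most frequent SA value a and a
-- row y of a most frequent value b ≠ a. A third value v occurs at most min(#a, #b) times,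
-- so 3·#v ≤ #a + #b + #v ≤ k and hence 2·#v ≤ k - 2 (using k ≥ 4 when #v = 1). Peeling
-- off such pairs splits any 2-diverse group into groups of 2 or 3 rows with distinct SA
-- values. Second, splitting a group never increases the cost, because a subgroup
-- disagrees on at most the coordinates its parent disagrees on. Every 2-diverse partition
-- therefore has a refinement of the required shape which is no more expensive, and among
-- the finitely many partitions of that shape a cheapest one exists.
module Submission where

open import Defs
open import Data.Bool using (Bool; true; false; not; T; T?)
open import Data.Empty using (⊥-elim)
open import Data.Fin using (Fin)
open import Data.Fin.Properties using () renaming (_≟_ to _≟F_)
open import Data.List using (List; []; _∷_; [_]; _++_; length; map; filter; concat; concatMap; allFin; tabulate)
open import Data.List.Properties
  using (length-map; map-∘; length-++; concat-++; ++-identityʳ; map-tabulate; length-tabulate;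
         filter-accept; filter-reject; filter-some; filter-none; filter-all)
open import Data.List.Extrema.Nat
  using (argmax; argmin; f[xs]≤f[argmax]; f[⊥]≤f[argmax]; f[argmin]≤f[xs]; argmin-all)
open import Data.List.Membership.Propositional using (_∈_; find; lose)
open import Data.List.Membership.Propositional.Properties
  using (∈-∃++; ∈-map⁺; ∈-map⁻; ∈-filter⁺; ∈-filter⁻; ∈-concatMap⁺; ∈-allFin)
import Data.List.Membership.DecPropositional as DecMembership
open import Data.List.Relation.Unary.Any using (here; there)
import Data.List.Relation.Unary.Any as Any
open import Data.List.Relation.Unary.All using (All; []; _∷_; all?)
import Data.List.Relation.Unary.All as All
open import Data.List.Relation.Unary.All.Properties
  using (¬All⇒Any¬; all-filter) renaming (map⁺ to All-map⁺; ++⁺ to All-++⁺)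
open import Data.List.Relation.Unary.AllPairs using ([]; _∷_)
open import Data.List.Relation.Unary.Unique.Propositional using (Unique)
open import Data.List.Relation.Unary.Unique.DecPropositional using (unique?)
open import Data.List.Relation.Binary.Permutation.Propositional
  using (_↭_; ↭-refl; ↭-reflexive; ↭-sym; ↭-trans; prep)
open import Data.List.Relation.Binary.Permutation.Propositional.Properties
  using (↭-length; filter-↭; shift; drop-mid; ∈-resp-↭; ↭-empty-inv)
  renaming (map⁺ to ↭-map⁺; ++⁺ to ↭-++⁺)
open import Data.List.Relation.Binary.Subset.Propositional using (_⊆_)
open import Data.List.Relation.Binary.Subset.Propositional.Properties
  using (⊆-trans; ⊆-reflexive-↭; xs⊆xs++ys; xs⊆ys++xs) renaming (map⁺ to ⊆-map⁺)
import Data.List.Relation.Binary.Sublist.Propositional as SublistRel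
import Data.List.Relation.Binary.Sublist.Propositional.Properties as Sublist
open import Data.Nat using (ℕ; zero; suc; _+_; _*_; _∸_; _≤_; _<_; z≤n; s≤s) renaming (_≟_ to _≟ℕ_)
open import Data.Nat.Properties
open import Data.Product using (Σ; _×_; _,_; proj₁; proj₂; map₂)
open import Data.Sum using (_⊎_; inj₁; inj₂)
open import Data.Unit using (tt)
open import Data.Vec using (Vec; lookup; toList)
import Data.Vec as Vec
open import Function using (_∘_; case_of_)
open import Relation.Binary.Definitions using (DecidableEquality)
open import Relation.Binary.PropositionalEquality
  using (_≡_; _≢_; refl; sym; trans; cong; subst; subst₂)
open import Relation.Nullary using (¬_; yes; no; ¬?; Dec)
open import Relation.Nullary.Decidable using (_×-dec_; _⊎-dec_)
open import Relation.Unary using (Decidable)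

module _ {s : ℕ} where

  occ-↭ : ∀ {v : Fin s} {us vs} → us ↭ vs → occ v us ≡ occ v vs
  occ-↭ {v} p = ↭-length (filter-↭ (_≟F v) p)

  occ-∷-≡ : ∀ {v : Fin s} vs → occ v (v ∷ vs) ≡ suc (occ v vs)
  occ-∷-≡ {v} vs = cong length (filter-accept (_≟F v) refl)

  occ-∷-≢ : ∀ {v w : Fin s} vs → w ≢ v → occ v (w ∷ vs) ≡ occ v vs
  occ-∷-≢ {v} vs w≢v = cong length (filter-reject (_≟F v) w≢v)

  occ-∷-≤ : ∀ {v : Fin s} w vs → occ v vs ≤ occ v (w ∷ vs)
  occ-∷-≤ {v} w vs with w ≟F v
  ... | yes _ = n≤1+n _
  ... | no _ = ≤-refl

  ∈⇒occ>0 : ∀ {v : Fin s} {vs} → v ∈ vs → 0 < occ v vs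
  ∈⇒occ>0 {v} v∈vs = filter-some (_≟F v) (Any.map sym v∈vs)

  occ>0⇒∈ : ∀ {v : Fin s} vs → 0 < occ v vs → v ∈ vs
  occ>0⇒∈ {v} (w ∷ ws) occ>0 with w ≟F v
  ... | yes w≡v = here (sym w≡v)
  ... | no _ = there (occ>0⇒∈ ws occ>0)

  Unique⇒occ≤1 : ∀ {v : Fin s} {vs} → Unique vs → occ v vs ≤ 1
  Unique⇒occ≤1 [] = z≤n
  Unique⇒occ≤1 {v} {w ∷ ws} (w∉ws ∷ ws-unique) with w ≟F v
  ... | yes refl =
    s≤s (≤-reflexive (cong length (filter-none (_≟F w) (All.map (λ w≢x x≡w → w≢x (sym x≡w)) w∉ws))))
  ... | no _ = Unique⇒occ≤1 ws-unique

  occ≤1⇒Unique : ∀ (vs : List (Fin s)) → (∀ v → occ v vs ≤ 1) → Unique vs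
  occ≤1⇒Unique [] _ = []
  occ≤1⇒Unique (w ∷ ws) occ≤1 =
    All.tabulate w∉ws ∷ occ≤1⇒Unique ws (λ v → ≤-trans (occ-∷-≤ w ws) (occ≤1 v))
    where
    w∉ws : ∀ {x} → x ∈ ws → w ≢ x
    w∉ws x∈ws refl = <⇒≱ (s≤s (∈⇒occ>0 x∈ws)) (subst (_≤ 1) (occ-∷-≡ ws) (occ≤1 w))

  occ₃≤length : ∀ {a b c : Fin s} → a ≢ b → a ≢ c → b ≢ c → ∀ vs →
    occ a vs + occ b vs + occ c vs ≤ length vs
  occ₃≤length a≢b a≢c b≢c [] = z≤n
  occ₃≤length {a} {b} {c} a≢b a≢c b≢c (w ∷ ws)
    with rest ← occ₃≤length a≢b a≢c b≢c ws | w ≟F a | w ≟F b | w ≟F c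
  ... | yes refl | yes refl | _        = ⊥-elim (a≢b refl)
  ... | yes refl | _        | yes refl = ⊥-elim (a≢c refl)
  ... | _        | yes refl | yes refl = ⊥-elim (b≢c refl)
  ... | yes _    | no _     | no _     = s≤s rest
  ... | no _     | yes _    | no _     =
    subst (_≤ suc (length ws)) (cong (_+ occ c ws) (sym (+-suc (occ a ws) (occ b ws)))) (s≤s rest)
  ... | no _     | no _     | yes _    =
    subst (_≤ suc (length ws)) (sym (+-suc (occ a ws + occ b ws) (occ c ws))) (s≤s rest)
  ... | no _     | no _     | no _     = m≤n⇒m≤1+n rest

double≤3⇒≤1 : ∀ {o k} → 2 * o ≤ k → k ≤ 3 → o ≤ 1
double≤3⇒≤1 {zero} _ _ = z≤n
double≤3⇒≤1 {suc zero} _ _ = ≤-refl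
double≤3⇒≤1 {suc (suc o)} 2o≤k k≤3 =
  ⊥-elim (<⇒≱ (s≤s ≤-refl) (≤-trans (*-monoʳ-≤ 2 (s≤s (s≤s (z≤n {o})))) (≤-trans 2o≤k k≤3)))

double-suc≤2+⇒double≤ : ∀ {c k} → 2 * suc c ≤ 2 + k → 2 * c ≤ k
double-suc≤2+⇒double≤ {c} {k} le = +-cancelˡ-≤ 2 (2 * c) k (subst (_≤ 2 + k) (*-suc 2 c) le)

dominated⇒double≤ : ∀ {o p q k} → o ≤ p → o ≤ q → p + q + o ≤ 2 + k → 2 ≤ k → 2 * o ≤ k
dominated⇒double≤ {zero} _ _ _ _ = z≤n
dominated⇒double≤ {suc zero} _ _ _ 2≤k = 2≤k
dominated⇒double≤ {suc (suc o)} {p} {q} {k} o≤p o≤q sum≤ _ = +-cancelˡ-≤ 2 _ _ (begin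
  2 + 2 * O       ≡⟨ cong (λ t → 2 + (O + t)) (+-identityʳ O) ⟩
  2 + (O + O)     ≤⟨ +-monoˡ-≤ (O + O) (s≤s (s≤s z≤n)) ⟩
  O + (O + O)     ≡⟨ sym (+-assoc O O O) ⟩
  O + O + O       ≤⟨ +-monoˡ-≤ O (+-mono-≤ o≤p o≤q) ⟩
  p + q + O       ≤⟨ sum≤ ⟩
  2 + k           ∎)
  where
  O = suc (suc o)
  open ≤-Reasoning

∈⇒↭∷ : ∀ {A : Set} {x : A} {xs} → x ∈ xs → Σ (List A) λ r → xs ↭ x ∷ r
∈⇒↭∷ {x = x} x∈xs with ∈-∃++ x∈xs
... | ys , zs , refl = ys ++ zs , shift x ys zs

∈⇒↭∷∷ : ∀ {A : Set} {x y : A} {xs} → x ∈ xs → y ∈ xs → x ≢ y →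
  Σ (List A) λ r → xs ↭ x ∷ y ∷ r
∈⇒↭∷∷ x∈xs y∈xs x≢y with ∈⇒↭∷ x∈xs
... | r₁ , xs↭ with ∈-resp-↭ xs↭ y∈xs
...   | here y≡x = ⊥-elim (x≢y (sym y≡x))
...   | there y∈r₁ with ∈⇒↭∷ y∈r₁
...     | r , r₁↭ = r , ↭-trans xs↭ (prep _ r₁↭)

module Labelled {A : Set} {s : ℕ} (label : A → Fin s) where

  count : Fin s → List A → ℕ
  count v xs = occ v (map label xs)

  Diverse₂ : List A → Set
  Diverse₂ xs = ∀ v → 2 * count v xs ≤ length xs

  SmallDistinct : List A → Set
  SmallDistinct g = (length g ≡ 2 ⊎ length g ≡ 3) × Unique (map label g)

  count-↭ : ∀ {v xs ys} → xs ↭ ys → count v xs ≡ count v ys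
  count-↭ p = occ-↭ (↭-map⁺ label p)

  withoutLabel : Fin s → List A → List A
  withoutLabel a = filter (λ z → ¬? (label z ≟F a))

  count-withoutLabel : ∀ {v a} → v ≢ a → ∀ xs → count v (withoutLabel a xs) ≡ count v xs
  count-withoutLabel v≢a [] = refl
  count-withoutLabel {v} {a} v≢a (x ∷ xs) with label x ≟F a
  ... | yes x≡a = trans (count-withoutLabel v≢a xs) (sym (occ-∷-≢ _ (λ x≡v → v≢a (trans (sym x≡v) x≡a))))
  ... | no _ with label x ≟F v
  ...   | yes _ = cong suc (count-withoutLabel v≢a xs)
  ...   | no _  = count-withoutLabel v≢a xs

  Diverse₂⇒2≤length : ∀ {x xs} → Diverse₂ (x ∷ xs) → 2 ≤ length (x ∷ xs)
  Diverse₂⇒2≤length {x} {xs} d =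
    ≤-trans (*-monoʳ-≤ 2 (∈⇒occ>0 {vs = map label (x ∷ xs)} (here refl))) (d (label x))

  Diverse₂⇒Unique : ∀ {xs} → Diverse₂ xs → length xs ≤ 3 → Unique (map label xs)
  Diverse₂⇒Unique {xs} d len≤3 = occ≤1⇒Unique (map label xs) (λ v → double≤3⇒≤1 (d v) len≤3)

  mostFrequentLabel : ∀ {z} xs → z ∈ xs →
    Σ (Fin s) λ a → 0 < count a xs × (∀ v → count v xs ≤ count a xs)
  mostFrequentLabel {z} xs z∈xs =
    argmax frequency (label z) (allFin s) ,
    ≤-trans (∈⇒occ>0 (∈-map⁺ label z∈xs)) (f[⊥]≤f[argmax] {f = frequency} (label z) (allFin s)) ,
    λ v → All.lookup (f[xs]≤f[argmax] {f = frequency} (label z) (allFin s)) (∈-allFin v)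
    where
    frequency : Fin s → ℕ
    frequency v = count v xs

  mostFrequent : ∀ {z} xs → z ∈ xs → Σ A λ x → x ∈ xs × (∀ v → count v xs ≤ count (label x) xs)
  mostFrequent xs z∈xs with mostFrequentLabel xs z∈xs
  ... | a , a-occurs , a-max with ∈-map⁻ label (occ>0⇒∈ (map label xs) a-occurs)
  ...   | x , x∈xs , refl = x , x∈xs , a-max

  otherLabel : ∀ {x xs} → Diverse₂ xs → x ∈ xs → Σ A λ y → y ∈ xs × label y ≢ label x
  otherLabel {x} {xs} d x∈xs =
    find (¬All⇒Any¬ (λ y → label y ≟F label x) xs all-labelled)
    where
    all-labelled : ¬ All (λ y → label y ≡ label x) xs
    all-labelled same =
      <⇒≱ (m<m+n (length xs) (≤-trans len>0 (m≤m+n _ 0)))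
          (subst (λ c → 2 * c ≤ length xs) count≡length (d (label x)))
      where
      count≡length : count (label x) xs ≡ length xs
      count≡length = trans (cong length (filter-all (_≟F label x) (All-map⁺ same))) (length-map label xs)
      len>0 : 0 < length xs
      len>0 = subst (0 <_) count≡length (∈⇒occ>0 (∈-map⁺ label x∈xs))

  Diverse₂-removePair : ∀ {xs x y r} → Diverse₂ xs → xs ↭ x ∷ y ∷ r → 2 ≤ length r →
    label x ≢ label y →
    (∀ v → count v xs ≤ count (label x) xs) →
    (∀ v → v ≢ label x → count v xs ≤ count (label y) xs) →
    Diverse₂ r
  Diverse₂-removePair {xs} {x} {y} {r} d xs↭ 2≤r x≢y x-max y-max v
    with label x ≟F v | label y ≟F v
  ... | yes refl | yes y≡x = ⊥-elim (x≢y (sym y≡x))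
  ... | yes refl | no y≢x  =
    double-suc≤2+⇒double≤ (subst₂ (λ c k → 2 * c ≤ k) count-x (↭-length xs↭) (d (label x)))
    where
    count-x : count (label x) xs ≡ suc (count (label x) r)
    count-x = trans (count-↭ xs↭)
      (trans (occ-∷-≡ (map label (y ∷ r))) (cong suc (occ-∷-≢ (map label r) y≢x)))
  ... | no _     | yes refl =
    double-suc≤2+⇒double≤ (subst₂ (λ c k → 2 * c ≤ k) count-y (↭-length xs↭) (d (label y)))
    where
    count-y : count (label y) xs ≡ suc (count (label y) r)
    count-y = trans (count-↭ xs↭) (trans (occ-∷-≢ (map label (y ∷ r)) x≢y) (occ-∷-≡ (map label r)))
  ... | no x≢v  | no y≢v   = subst (λ c → 2 * c ≤ length r) count-v
    (dominated⇒double≤ (x-max v) (y-max v (λ v≡x → x≢v (sym v≡x))) three≤ 2≤r)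
    where
    count-v : count v xs ≡ count v r
    count-v = trans (count-↭ xs↭) (trans (occ-∷-≢ (map label (y ∷ r)) x≢v) (occ-∷-≢ (map label r) y≢v))
    three≤ : count (label x) xs + count (label y) xs + count v xs ≤ 2 + length r
    three≤ = subst (count (label x) xs + count (label y) xs + count v xs ≤_)
      (trans (length-map label xs) (↭-length xs↭)) (occ₃≤length x≢y x≢v y≢v (map label xs))

  removablePair : ∀ {xs} → Diverse₂ xs → 4 ≤ length xs →
    Σ A λ x → Σ A λ y → Σ (List A) λ r → xs ↭ x ∷ y ∷ r × label x ≢ label y × Diverse₂ r
  removablePair {xs@(_ ∷ _)} d 4≤length
    with mostFrequent xs (here refl)
  ... | x , x∈xs , x-max
    with otherLabel d x∈xs
  ... | y₀ , y₀∈xs , y₀≢x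
    with mostFrequent (withoutLabel (label x) xs) (∈-filter⁺ (λ w → ¬? (label w ≟F label x)) y₀∈xs y₀≢x)
  ... | y , y∈rest , y-max-rest
    with ∈-filter⁻ (λ w → ¬? (label w ≟F label x)) {xs = xs} y∈rest
  ... | y∈xs , y≢x
    with ∈⇒↭∷∷ x∈xs y∈xs (λ x≡y → y≢x (cong label (sym x≡y)))
  ... | r , xs↭ = x , y , r , xs↭ , x≢y , Diverse₂-removePair d xs↭ 2≤r x≢y x-max y-max
    where
    x≢y : label x ≢ label y
    x≢y x≡y = y≢x (sym x≡y)
    y-max : ∀ v → v ≢ label x → count v xs ≤ count (label y) xs
    y-max v v≢x = subst₂ _≤_ (count-withoutLabel v≢x xs) (count-withoutLabel y≢x xs) (y-max-rest v)
    2≤r : 2 ≤ length r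
    2≤r = +-cancelˡ-≤ 2 2 (length r) (subst (4 ≤_) (↭-length xs↭) 4≤length)

  splitSmallDistinct : ∀ k xs → length xs ≡ 2 + k → Diverse₂ xs →
    Σ (List (List A)) λ gs → All SmallDistinct gs × concat gs ↭ xs
  splitSmallDistinct zero xs len d =
    [ xs ] , (inj₁ len , Diverse₂⇒Unique d (≤-trans (≤-reflexive len) (n≤1+n 2))) ∷ [] ,
    ↭-reflexive (++-identityʳ xs)
  splitSmallDistinct (suc zero) xs len d =
    [ xs ] , (inj₂ len , Diverse₂⇒Unique d (≤-reflexive len)) ∷ [] , ↭-reflexive (++-identityʳ xs)
  splitSmallDistinct (suc (suc k)) xs len d with removablePair d (subst (4 ≤_) (sym len) (+-monoʳ-≤ 4 z≤n))
  ... | x , y , r , xs↭ , x≢y , r-diverse with splitSmallDistinct k r len-r r-diverse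
    where
    len-r : length r ≡ 2 + k
    len-r = suc-injective (suc-injective (trans (sym (↭-length xs↭)) len))
  ...   | gs , gs-small , gs↭r =
    (x ∷ y ∷ []) ∷ gs , (inj₁ refl , (x≢y ∷ []) ∷ [] ∷ []) ∷ gs-small ,
    ↭-trans (prep x (prep y gs↭r)) (↭-sym xs↭)

  partitionSmallDistinct : ∀ {x xs} → Diverse₂ (x ∷ xs) →
    Σ (List (List A)) λ gs → All SmallDistinct gs × concat gs ↭ x ∷ xs
  partitionSmallDistinct {x} {xs} d =
    splitSmallDistinct (length xs ∸ 1) (x ∷ xs) (sym (m+[n∸m]≡n (Diverse₂⇒2≤length d))) d

module _ {s : ℕ} where

  allSameᵇ-∷⁻ : ∀ (x : Fin s) ys → allSameᵇ (x ∷ ys) ≡ true → All (_≡ x) ys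
  allSameᵇ-∷⁻ x [] _ = []
  allSameᵇ-∷⁻ x (y ∷ ys) same with y ≟F x
  ... | yes y≡x = y≡x ∷ allSameᵇ-∷⁻ x ys same
  ... | no _ = case same of λ ()

  allSameᵇ-∷⁺ : ∀ (x : Fin s) {ys} → All (_≡ x) ys → allSameᵇ (x ∷ ys) ≡ true
  allSameᵇ-∷⁺ x [] = refl
  allSameᵇ-∷⁺ x {y ∷ ys} (y≡x ∷ rest) with y ≟F x
  ... | yes _ = allSameᵇ-∷⁺ x rest
  ... | no y≢x = ⊥-elim (y≢x y≡x)

  allSameᵇ-antitone : ∀ {xs ys : List (Fin s)} → xs ⊆ ys → allSameᵇ ys ≡ true → allSameᵇ xs ≡ true
  allSameᵇ-antitone {[]} _ _ = refl
  allSameᵇ-antitone {x ∷ xs} {[]} xs⊆ys _ = case xs⊆ys (here refl) of λ ()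
  allSameᵇ-antitone {x ∷ xs} {y ∷ ys} xs⊆ys same =
    allSameᵇ-∷⁺ x (All.tabulate λ w∈xs →
      trans (≡y (xs⊆ys (there w∈xs))) (sym (≡y (xs⊆ys (here refl)))))
    where
    ≡y : ∀ {w} → w ∈ y ∷ ys → w ≡ y
    ≡y = All.lookup (refl ∷ allSameᵇ-∷⁻ y ys same)

T-not-antitone : ∀ {a b} → (b ≡ true → a ≡ true) → T (not a) → T (not b)
T-not-antitone {b = false} _ _ = tt
T-not-antitone {true} {true} _ ()
T-not-antitone {false} {true} b⇒a _ = case b⇒a refl of λ ()

disagreeCount-mono : ∀ {m s} {xs ys : List (Row m s)} → xs ⊆ ys → disagreeCount xs ≤ disagreeCount ys
disagreeCount-mono {m} {s} {xs} {ys} xs⊆ys =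
  Sublist.length-mono-≤
    (Sublist.filter⁺ (T? ∘ disagreesOn xs) (T? ∘ disagreesOn ys) disagrees-mono (SublistRel.⊆-refl {x = allFin m}))
  where
  column : Fin m → List (Row m s) → List (Fin s)
  column j = map (λ r → lookup (qi r) j)
  disagreesOn : List (Row m s) → Fin m → Bool
  disagreesOn rows j = not (allSameᵇ (column j rows))
  disagrees-mono : ∀ {i j} → i ≡ j → T (disagreesOn xs i) → T (disagreesOn ys j)
  disagrees-mono {j = j} refl = T-not-antitone (allSameᵇ-antitone (⊆-map⁺ (λ r → lookup (qi r) j) xs⊆ys))

listsUpTo : ∀ {A : Set} → List A → ℕ → List (List A)
listsUpTo G zero = [ [] ]
listsUpTo G (suc k) = [] ∷ concatMap (λ g → map (g ∷_) (listsUpTo G k)) G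

∈-listsUpTo : ∀ {A : Set} {G : List A} {xs} k → All (_∈ G) xs → length xs ≤ k → xs ∈ listsUpTo G k
∈-listsUpTo zero [] _ = here refl
∈-listsUpTo (suc k) [] _ = here refl
∈-listsUpTo (suc k) (x∈G ∷ xs∈G) (s≤s len≤k) =
  there (∈-concatMap⁺ _ (lose x∈G (∈-map⁺ (_ ∷_) (∈-listsUpTo k xs∈G len≤k))))

module _ {A : Set} (_≟_ : DecidableEquality A) where
  open DecMembership _≟_ using (_∈?_)

  _↭?_ : (xs ys : List A) → Dec (xs ↭ ys)
  [] ↭? [] = yes ↭-refl
  [] ↭? (y ∷ ys) = no (λ []↭ → case ↭-empty-inv (↭-sym []↭) of λ ())
  (x ∷ xs) ↭? ys with x ∈? ys
  ... | no x∉ys = no (λ xs↭ys → x∉ys (∈-resp-↭ xs↭ys (here refl)))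
  ... | yes x∈ys with ∈-∃++ x∈ys
  ...   | us , vs , refl with xs ↭? (us ++ vs)
  ...     | yes xs↭ = yes (↭-trans (prep x xs↭) (↭-sym (shift x us vs)))
  ...     | no xs↮ = no (λ x∷xs↭ → xs↮ (drop-mid [] us x∷xs↭))

length≤length-concat : ∀ {A : Set} (gs : List (List A)) → All (λ g → 1 ≤ length g) gs →
  length gs ≤ length (concat gs)
length≤length-concat [] [] = z≤n
length≤length-concat (g ∷ gs) (1≤g ∷ rest) =
  ≤-trans (+-mono-≤ 1≤g (length≤length-concat gs rest)) (≤-reflexive (sym (length-++ g)))

2or3⇒2≤ : ∀ {k} → k ≡ 2 ⊎ k ≡ 3 → 2 ≤ k
2or3⇒2≤ (inj₁ refl) = ≤-refl
2or3⇒2≤ (inj₂ refl) = n≤1+n 2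

2or3⇒≤3 : ∀ {k} → k ≡ 2 ⊎ k ≡ 3 → k ≤ 3
2or3⇒≤3 (inj₁ refl) = n≤1+n 2
2or3⇒≤3 (inj₂ refl) = ≤-refl

module _ {m s n : ℕ} (T : Table m s n) where

  cost-++ : ∀ P Q → cost T (P ++ Q) ≡ cost T P + cost T Q
  cost-++ [] Q = refl
  cost-++ (g ∷ P) Q =
    trans (cong (groupCost (rowsOf T g) +_) (cost-++ P Q)) (sym (+-assoc (groupCost (rowsOf T g)) (cost T P) (cost T Q)))

  cost-of-subgroups : ∀ gs {g} → concat gs ⊆ g → cost T gs ≤ length (concat gs) * disagreeCount (rowsOf T g)
  cost-of-subgroups [] _ = z≤n
  cost-of-subgroups (h ∷ gs) {g} h∷gs⊆g = begin
    length (rowsOf T h) * disagreeCount (rowsOf T h) + cost T gs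
      ≤⟨ +-mono-≤ (*-mono-≤ (≤-reflexive (length-map _ h)) (disagreeCount-mono (⊆-map⁺ (lookup T) h⊆g)))
                  (cost-of-subgroups gs (⊆-trans (xs⊆ys++xs (concat gs) h) h∷gs⊆g)) ⟩
    length h * D + length (concat gs) * D
      ≡⟨ sym (*-distribʳ-+ D (length h) _) ⟩
    (length h + length (concat gs)) * D
      ≡⟨ cong (_* D) (sym (length-++ h)) ⟩
    length (h ++ concat gs) * D ∎
    where
    open ≤-Reasoning
    D = disagreeCount (rowsOf T g)
    h⊆g : h ⊆ g
    h⊆g = ⊆-trans (xs⊆xs++ys h (concat gs)) h∷gs⊆g

  label : Fin n → Fin s
  label i = sa (lookup T i)

  open Labelled label

  sa-rowsOf : ∀ g → map sa (rowsOf T g) ≡ map label g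
  sa-rowsOf g = sym (map-∘ g)

  Diverse⇒Diverse₂ : ∀ {g} → Diverse 2 (rowsOf T g) → Diverse₂ g
  Diverse⇒Diverse₂ {g} d v = subst₂ (λ vs k → 2 * occ v vs ≤ k) (sa-rowsOf g) (length-map (lookup T) g) (d v)

  SmallDistinct⇒SmallDistinctGroup : ∀ {g} → SmallDistinct g → SmallDistinctGroup T g
  SmallDistinct⇒SmallDistinctGroup {g} = map₂ (subst Unique (sym (sa-rowsOf g)))

  SmallDistinctGroup⇒Diverse : ∀ {g} → SmallDistinctGroup T g → Diverse 2 (rowsOf T g)
  SmallDistinctGroup⇒Diverse {g} (len , unique) v =
    ≤-trans (*-monoʳ-≤ 2 (Unique⇒occ≤1 unique)) (subst (2 ≤_) (sym (length-map (lookup T) g)) (2or3⇒2≤ len))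

  refineGroup : ∀ {g} → NonEmptyL g → Diverse 2 (rowsOf T g) →
    Σ (Partition n) λ gs → All (SmallDistinctGroup T) gs × concat gs ↭ g × cost T gs ≤ groupCost (rowsOf T g)
  refineGroup {g} (nonEmpty _ _) d with partitionSmallDistinct (Diverse⇒Diverse₂ d)
  ... | gs , gs-small , gs↭g = gs , All.map SmallDistinct⇒SmallDistinctGroup gs-small , gs↭g , (begin
    cost T gs                  ≤⟨ cost-of-subgroups gs (⊆-reflexive-↭ gs↭g) ⟩
    length (concat gs) * D     ≡⟨ cong (_* D) (trans (↭-length gs↭g) (sym (length-map (lookup T) g))) ⟩
    groupCost (rowsOf T g)     ∎)
    where
    open ≤-Reasoning
    D = disagreeCount (rowsOf T g)

  refinePartition : ∀ Q → All NonEmptyL Q → All (λ g → Diverse 2 (rowsOf T g)) Q →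
    Σ (Partition n) λ Q' → All (SmallDistinctGroup T) Q' × concat Q' ↭ concat Q × cost T Q' ≤ cost T Q
  refinePartition [] [] [] = [] , [] , ↭-refl , z≤n
  refinePartition (g ∷ Q) (g-ne ∷ Q-ne) (g-div ∷ Q-div)
    with refineGroup g-ne g-div | refinePartition Q Q-ne Q-div
  ... | gs , gs-small , gs↭g , gs≤g | Q' , Q'-small , Q'↭Q , Q'≤Q =
    gs ++ Q' , All-++⁺ gs-small Q'-small ,
    subst (_↭ concat (g ∷ Q)) (concat-++ gs Q') (↭-++⁺ gs↭g Q'↭Q) ,
    subst (_≤ cost T (g ∷ Q)) (sym (cost-++ gs Q')) (+-mono-≤ gs≤g Q'≤Q)

  IsCandidate : Partition n → Set
  IsCandidate P = All (SmallDistinctGroup T) P × concat P ↭ allFin n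

  candidate? : Decidable IsCandidate
  candidate? P = all? smallDistinctGroup? P ×-dec (_↭?_ _≟F_ (concat P) (allFin n))
    where
    smallDistinctGroup? : Decidable (SmallDistinctGroup T)
    smallDistinctGroup? g = ((length g ≟ℕ 2) ⊎-dec (length g ≟ℕ 3)) ×-dec unique? _≟F_ (map sa (rowsOf T g))

  enumerated : List (Partition n)
  enumerated = listsUpTo (listsUpTo (allFin n) 3) n

  candidates : List (Partition n)
  candidates = filter candidate? enumerated

  candidate⇒DiversePartition : ∀ {P} → IsCandidate P → IsDiversePartition 2 T P
  candidate⇒DiversePartition (small , P↭) =
    (All.map nonEmpty-of-small small , P↭) , All.map SmallDistinctGroup⇒Diverse small
    where
    nonEmpty-of-small : ∀ {g} → SmallDistinctGroup T g → NonEmptyL g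
    nonEmpty-of-small {x ∷ xs} _ = nonEmpty x xs
    nonEmpty-of-small {[]} (len , _) = case 2or3⇒2≤ len of λ ()

  refinedCandidate : ∀ {Q} → IsDiversePartition 2 T Q →
    Σ (Partition n) λ P → P ∈ candidates × cost T P ≤ cost T Q
  refinedCandidate {Q} ((Q-ne , Q↭) , Q-div) with refinePartition Q Q-ne Q-div
  ... | P , P-small , P↭Q , P≤Q = P , ∈-filter⁺ candidate? P-enumerated (P-small , P↭) , P≤Q
    where
    P↭ : concat P ↭ allFin n
    P↭ = ↭-trans P↭Q Q↭
    groups-enumerated : All (_∈ listsUpTo (allFin n) 3) P
    groups-enumerated =
      All.map (λ (len , _) → ∈-listsUpTo 3 (All.tabulate (λ {i} _ → ∈-allFin i)) (2or3⇒≤3 len)) P-small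
    P-enumerated : P ∈ enumerated
    P-enumerated = ∈-listsUpTo n groups-enumerated (begin
      length P              ≤⟨ length≤length-concat P (All.map (λ (len , _) → ≤-trans (n≤1+n 1) (2or3⇒2≤ len)) P-small) ⟩
      length (concat P)     ≡⟨ ↭-length P↭ ⟩
      length (allFin n)     ≡⟨ length-tabulate (λ i → i) ⟩
      n                     ∎)
      where open ≤-Reasoning

  cheapestCandidate : ∀ {P₀} → P₀ ∈ candidates →
    Σ (Partition n) λ P → IsCandidate P × (∀ {Q} → Q ∈ candidates → cost T P ≤ cost T Q)
  cheapestCandidate {P₀} P₀∈ =
    argmin (cost T) P₀ candidates ,
    argmin-all (cost T) (proj₂ (∈-filter⁻ candidate? {xs = enumerated} P₀∈)) (all-filter candidate? enumerated) ,
    All.lookup (f[argmin]≤f[xs] P₀ candidates)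

tabulate-lookup : ∀ {A : Set} {n} (xs : Vec A n) → tabulate (lookup xs) ≡ toList xs
tabulate-lookup Vec.[] = refl
tabulate-lookup (x Vec.∷ xs) = cong (x ∷_) (tabulate-lookup xs)

rowsOf-allFin : ∀ {m s n} (T : Table m s n) → rowsOf T (allFin n) ≡ toList T
rowsOf-allFin T = trans (map-tabulate (λ i → i) (lookup T)) (tabulate-lookup T)

wholeTable : ∀ {m s n} (T : Table m s n) → Diverse 2 (toList T) → Σ (Partition n) (IsDiversePartition 2 T)
wholeTable Vec.[] _ = [] , ([] , ↭-refl) , []
wholeTable T@(_ Vec.∷ _) d =
  [ allFin _ ] , (nonEmpty _ _ ∷ [] , ↭-reflexive (++-identityʳ _)) ,
  subst (Diverse 2) (sym (rowsOf-allFin T)) d ∷ []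

lemma2 : ∀ {m s n} (T : Table m s n) → Diverse 2 (toList T) →
    Σ (Partition n) (λ P → IsMinCostDiversePartition 2 T P × All (SmallDistinctGroup T) P)
lemma2 T d with refinedCandidate T (proj₂ (wholeTable T d))
... | _ , P₀∈ , _ with cheapestCandidate T P₀∈
...   | P , P-candidate , P-cheapest = P , (candidate⇒DiversePartition T P-candidate , P-minimal) , proj₁ P-candidate
  where
  P-minimal : ∀ Q → IsDiversePartition 2 T Q → cost T P ≤ cost T Q
  P-minimal Q Q-div with refinedCandidate T Q-div
  ... | Q' , Q'∈ , Q'≤Q = ≤-trans (P-cheapest Q'∈) Q'≤Q
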